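{- Let $M$ be a finite abelian group of order $m$, $J$ a Jacobi function on $M$, and suppose $c\in\hat{M}$ with $c^2=1$ and a bijection $i\colon \hat{M}\setminus\{c\}\to\hat{M}\setminus\{1\}$ satisfy $i(x)=x\,i(x^{ -1})$ for all $x\in\hat{M}\setminus\{c\}$ and $J(\alpha,\beta)=\frac{1}{m}\sum_{x\in\hat{M}\setminus\{c\}}\alpha(i(x))\beta(i(x)x^{ -1})$ for all $\alpha,\beta\in M$. Let $F=\hat{M}\sqcup\{0\}$ and define $\oplus$ on $F$ by: $0$ is the identity for $\oplus$, and for nonzero $x,y$, $x\oplus y=0$ if $x=cy$ and $x\oplus y=x\,i(x/y)^{ -1}$ otherwise. Then for all $\alpha,\beta\in M$, \[ J(\alpha,\beta)=\frac{1}{m}\sum_{\substack{x\oplus y=1,\\ x,y\in F\setminus\{0\}}}\alpha(x)\beta(y). \]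
   Context: $\hat{M}$ is the Pontryagin dual of $M$ (written multiplicatively, identity $1$), and $\alpha(x)$ is the pairing of $\alpha\in M$ with $x\in\hat{M}$. $\delta(\alpha)=1$ if $\alpha$ is the identity of $M$, else $0$. A Jacobi function on $M$ is a function $J \colon M\times M \to \mathbf{C}$ satisfying: (A) $J(\alpha,\beta)=J(\beta,\alpha)$; (B) with $J^*(\alpha,\beta)=J(\alpha,\beta)-\delta(\alpha)-\delta(\beta)$, $J^*(\alpha,\beta)J^*(\alpha\beta,\gamma)=J^*(\alpha,\beta\gamma)J^*(\beta,\gamma)$ for all $\alpha,\beta,\gamma$; (C) $\sum_{\beta\in M} J(\alpha_1\beta,\alpha_2\beta^{ -1})J(\alpha_3\beta,\alpha_4\beta^{ -1}) = J(\alpha_1\alpha_4,\alpha_2\alpha_3)$ for all $\alpha_1,\dots,\alpha_4 \in M$. -}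

module Defs where

open import Level using (Level)
open import Data.Nat.Base using (ℕ; zero; suc)
open import Data.Fin.Base using (Fin)
open import Data.Fin.Properties using (_≟_)
open import Data.Maybe.Base using (Maybe; just; nothing)
open import Data.Maybe.Properties using (≡-dec)
open import Data.Product.Base using (Σ; _×_; _,_)
open import Relation.Nullary.Decidable.Core using (Dec; yes; no)
open import Relation.Nullary.Negation.Core using (¬_)
open import Relation.Binary.PropositionalEquality.Core using (_≡_; _≢_)
open import Algebra.Bundles using (CommutativeRing)
open import Algebra.Structures using (IsAbelianGroup)
import Algebra.Definitions.RawMonoid as RM

-- A finite abelian group of order m, realised (up to isomorphism) on the
-- carrier Fin m, with propositional equality.  Written multiplicatively.

record FinAbGroup (m : ℕ) : Set where
  infixl 7 _∙_
  infix 8 _⁻¹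
  field
    _∙_ : Fin m → Fin m → Fin m
    ε   : Fin m
    _⁻¹ : Fin m → Fin m
    isAbelianGroup : IsAbelianGroup _≡_ _∙_ ε _⁻¹

-- Everything below lives over a commutative ring K of scalars
-- (standing in for ℂ, which the library lacks).

module _ {c ℓ : Level} (K : CommutativeRing c ℓ) where
  open CommutativeRing K

  ∑ : {n : ℕ} → (Fin n → Carrier) → Carrier
  ∑ = RM.sum +-rawMonoid

  when : {p : Level} {P : Set p} → Dec P → Carrier → Carrier
  when (yes _) v = v
  when (no  _) _ = 0#

  natK : ℕ → Carrier
  natK zero    = 0#
  natK (suc n) = 1# + natK n

  module _ {m : ℕ} (M : FinAbGroup m) where
    open FinAbGroup M

    δ : Fin m → Carrier
    δ α with α ≟ ε
    ... | yes _ = 1#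
    ... | no  _ = 0#

    Jstar : (Fin m → Fin m → Carrier) → Fin m → Fin m → Carrier
    Jstar J α β = J α β - δ α - δ β

    record IsJacobi (J : Fin m → Fin m → Carrier) : Set (c Level.⊔ ℓ) where
      field
        symm  : ∀ α β → J α β ≈ J β α
        cocyc : ∀ α β γ →
          Jstar J α β * Jstar J (α ∙ β) γ ≈ Jstar J α (β ∙ γ) * Jstar J β γ
        conv  : ∀ α₁ α₂ α₃ α₄ →
          ∑ (λ β → J (α₁ ∙ β) (α₂ ∙ β ⁻¹) * J (α₃ ∙ β) (α₄ ∙ β ⁻¹))
            ≈ J (α₁ ∙ α₄) (α₂ ∙ α₃)

  -- For K = ℂ this
  -- identifies X with the Pontryagin dual M̂, with ⟨ α , x ⟩ = α(x).
  record IsDualPairing {m : ℕ} (M X : FinAbGroup m)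
                       (⟨_,_⟩ : Fin m → Fin m → Carrier) : Set (c Level.⊔ ℓ) where
    private
      module M = FinAbGroup M
      module X = FinAbGroup X
    field
      mult-left  : ∀ α β x → ⟨ α M.∙ β , x ⟩ ≈ ⟨ α , x ⟩ * ⟨ β , x ⟩
      mult-right : ∀ α x y → ⟨ α , x X.∙ y ⟩ ≈ ⟨ α , x ⟩ * ⟨ α , y ⟩
      nondeg-left  : ∀ α → (∀ x → ⟨ α , x ⟩ ≈ 1#) → α ≡ M.ε
      nondeg-right : ∀ x → (∀ α → ⟨ α , x ⟩ ≈ 1#) → x ≡ X.ε

-- The addition ⊕ on F = M̂ ⊔ {0}, modelled as Maybe (Fin m) with
-- nothing = 0.  The map i : M̂∖{c} → M̂∖{1} is given as a total function
-- (its value at c is never used).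

module _ {m : ℕ} (X : FinAbGroup m) (c : Fin m) (i : Fin m → Fin m) where
  open FinAbGroup X

  infixl 6 _⊕_
  _⊕_ : Maybe (Fin m) → Maybe (Fin m) → Maybe (Fin m)
  nothing ⊕ y       = y
  just x  ⊕ nothing = just x
  just x  ⊕ just y with x ≟ c ∙ y
  ... | yes _ = nothing
  ... | no  _ = just (x ∙ (i (x ∙ y ⁻¹)) ⁻¹)

  record IsBijectionOff : Set where
    field
      maps-to    : ∀ x → x ≢ c → i x ≢ ε
      injective  : ∀ x y → x ≢ c → y ≢ c → i x ≡ i y → x ≡ y
      surjective : ∀ y → y ≢ ε → Σ (Fin m) (λ x → (x ≢ c) × (i x ≡ y))

_≟F_ : {m : ℕ} → (x y : Maybe (Fin m)) → Dec (x ≡ y)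
_≟F_ = ≡-dec _≟_

{-# OPTIONS --safe #-}

-- Put z = x y⁻¹.  By definition of ⊕, x ⊕ y = 1 holds exactly when x ≠ c y
-- and x = i(z); the first condition says z ≠ c, and then y = i(z) z⁻¹.  So
-- (x, y) ↦ z is a bijection from the solutions of x ⊕ y = 1 in F ∖ {0} onto
-- M̂ ∖ {c}, which turns the sum of the claim into the sum defining J.
module Submission where

open import Defs
open import Level using (Level; 0ℓ)
open import Data.Nat.Base using (ℕ; suc)
open import Data.Fin.Base using (Fin; punchIn)
open import Data.Fin.Properties using (_≟_; punchInᵢ≢i)
open import Data.Fin.Permutation using (Permutation; permutation)
open import Data.Maybe.Base using (just)
open import Data.Maybe.Properties using (just-injective)
open import Data.Product.Base using (_×_; _,_)
open import Function.Bundles using (_⇔_; mk⇔; module Equivalence)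
open import Relation.Nullary.Decidable.Core using (Dec; yes; no; ¬?; _×-dec_)
open import Relation.Nullary.Negation using (¬_; contradiction)
open import Relation.Binary.PropositionalEquality.Core as ≡ using (_≡_; _≢_)
open import Algebra.Bundles using (AbelianGroup; CommutativeRing)
import Algebra.Properties.AbelianGroup as AbelianGroupProperties
import Algebra.Properties.CommutativeMonoid.Sum as SumProperties
import Relation.Binary.Reasoning.Setoid as SetoidReasoning

finAbGroup⇒abelianGroup : {m : ℕ} → FinAbGroup m → AbelianGroup 0ℓ 0ℓ
finAbGroup⇒abelianGroup {m} X = record
  { Carrier = Fin m ; _≈_ = _≡_ ; _∙_ = _∙_ ; ε = ε ; _⁻¹ = _⁻¹
  ; isAbelianGroup = isAbelianGroup }
  where open FinAbGroup X

module AbelianGroupDivision {g ℓ : Level} (G : AbelianGroup g ℓ) where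
  open AbelianGroup G
  open AbelianGroupProperties G
  open SetoidReasoning setoid

  x∙[x∙y⁻¹]⁻¹≈y : ∀ x y → x ∙ (x ∙ y ⁻¹) ⁻¹ ≈ y
  x∙[x∙y⁻¹]⁻¹≈y x y = begin
    x ∙ (x ∙ y ⁻¹) ⁻¹  ≈⟨ ∙-congˡ (⁻¹-anti-homo‿- x y) ⟩
    x ∙ (y ∙ x ⁻¹)     ≈⟨ assoc x y (x ⁻¹) ⟨
    x ∙ y ∙ x ⁻¹       ≈⟨ xyx⁻¹≈y x y ⟩
    y                  ∎

  x≈c∙[x∙z⁻¹]⇔z≈c : ∀ c x z → (x ≈ c ∙ (x ∙ z ⁻¹)) ⇔ (z ≈ c)
  x≈c∙[x∙z⁻¹]⇔z≈c c x z = mk⇔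
    (λ x≈c∙[x∙z⁻¹] → sym (x∙y⁻¹≈ε⇒x≈y c z
      (identityʳ-unique x (c ∙ z ⁻¹) (sym (trans x≈c∙[x∙z⁻¹] c∙[x∙z⁻¹]≈x∙[c∙z⁻¹])))))
    (λ z≈c → begin
      x                  ≈⟨ identityʳ x ⟨
      x ∙ ε              ≈⟨ ∙-congˡ (x≈y⇒x∙y⁻¹≈ε (sym z≈c)) ⟨
      x ∙ (c ∙ z ⁻¹)     ≈⟨ c∙[x∙z⁻¹]≈x∙[c∙z⁻¹] ⟨
      c ∙ (x ∙ z ⁻¹)     ∎)
    where
    c∙[x∙z⁻¹]≈x∙[c∙z⁻¹] : c ∙ (x ∙ z ⁻¹) ≈ x ∙ (c ∙ z ⁻¹)
    c∙[x∙z⁻¹]≈x∙[c∙z⁻¹] = begin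
      c ∙ (x ∙ z ⁻¹)  ≈⟨ assoc c x (z ⁻¹) ⟨
      c ∙ x ∙ z ⁻¹    ≈⟨ ∙-congʳ (comm c x) ⟩
      x ∙ c ∙ z ⁻¹    ≈⟨ assoc x c (z ⁻¹) ⟩
      x ∙ (c ∙ z ⁻¹)  ∎

module IndicatorSums {a ℓ : Level} (K : CommutativeRing a ℓ) where
  open CommutativeRing K
  open SumProperties +-commutativeMonoid using (sum-remove; sum-cong-≋; sum-replicate-zero)
  open SetoidReasoning setoid

  when-cong-⇔ : {p q : Level} {P : Set p} {Q : Set q} (P? : Dec P) (Q? : Dec Q) →
                P ⇔ Q → ∀ v → when K P? v ≈ when K Q? v
  when-cong-⇔ (yes _)  (yes _)  _   _ = refl
  when-cong-⇔ (yes p)  (no ¬q)  P⇔Q _ = contradiction (Equivalence.to P⇔Q p) ¬q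
  when-cong-⇔ (no ¬p)  (yes q)  P⇔Q _ = contradiction (Equivalence.from P⇔Q q) ¬p
  when-cong-⇔ (no _)   (no _)   _   _ = refl

  when-×-dec : {p q : Level} {P : Set p} {Q : Set q} (P? : Dec P) (Q? : Dec Q) →
               ∀ v → when K (P? ×-dec Q?) v ≈ when K P? (when K Q? v)
  when-×-dec (yes _) (yes _) _ = refl
  when-×-dec (yes _) (no _)  _ = refl
  when-×-dec (no _)  _       _ = refl

  when-yes : {p : Level} {P : Set p} (P? : Dec P) → P → ∀ v → when K P? v ≈ v
  when-yes (yes _) _ _ = refl
  when-yes (no ¬p) p _ = contradiction p ¬p

  when-¬ : {p : Level} {P : Set p} (P? : Dec P) → ¬ P → ∀ v → when K P? v ≈ 0#
  when-¬ (yes p) ¬p _ = contradiction p ¬p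
  when-¬ (no _)  _  _ = refl

  ∑-when-≡ : {n : ℕ} (t : Fin n) (f : Fin n → Carrier) →
             ∑ K (λ x → when K (x ≟ t) (f x)) ≈ f t
  ∑-when-≡ {suc n} t f = begin
    ∑ K (λ x → when K (x ≟ t) (f x))
      ≈⟨ sum-remove {i = t} (λ x → when K (x ≟ t) (f x)) ⟩
    when K (t ≟ t) (f t) + ∑ K (λ j → when K (punchIn t j ≟ t) (f (punchIn t j)))
      ≈⟨ +-cong (when-yes (t ≟ t) ≡.refl (f t))
                (sum-cong-≋ (λ j → when-¬ (punchIn t j ≟ t) (punchInᵢ≢i t j) _)) ⟩
    f t + ∑ K {n} (λ _ → 0#)
      ≈⟨ +-congˡ (sum-replicate-zero n) ⟩
    f t + 0#
      ≈⟨ +-identityʳ (f t) ⟩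
    f t ∎

module SolutionsOf⊕≡1 {m : ℕ} (X : FinAbGroup m) (c : Fin m) (i : Fin m → Fin m) where
  open FinAbGroup X
  open AbelianGroupDivision (finAbGroup⇒abelianGroup X)
  open AbelianGroupProperties (finAbGroup⇒abelianGroup X) using (x∙y⁻¹≈ε⇒x≈y; x≈y⇒x∙y⁻¹≈ε)

  x⊕y≡1⇔ : ∀ x y → (_⊕_ X c i (just x) (just y) ≡ just ε) ⇔ (x ≢ c ∙ y × x ≡ i (x ∙ y ⁻¹))
  x⊕y≡1⇔ x y with x ≟ c ∙ y
  ... | yes x≡cy = mk⇔ (λ ()) (λ (x≢cy , _) → contradiction x≡cy x≢cy)
  ... | no  x≢cy = mk⇔
    (λ x∙i⁻¹≡ε → x≢cy , x∙y⁻¹≈ε⇒x≈y x (i (x ∙ y ⁻¹)) (just-injective x∙i⁻¹≡ε))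
    (λ (_ , x≡i) → ≡.cong just (x≈y⇒x∙y⁻¹≈ε x≡i))

  x⊕x∙z⁻¹≡1⇔ : ∀ x z → (_⊕_ X c i (just x) (just (x ∙ z ⁻¹)) ≡ just ε) ⇔ (x ≡ i z × z ≢ c)
  x⊕x∙z⁻¹≡1⇔ x z = mk⇔
    (λ x⊕y≡1 → let (x≢cy , x≡i[x/y]) = Equivalence.to (x⊕y≡1⇔ x y) x⊕y≡1 in
      ≡.trans x≡i[x/y] i[x/y]≡iz , λ z≡c → x≢cy (Equivalence.from x≡cy⇔z≡c z≡c))
    (λ (x≡iz , z≢c) → Equivalence.from (x⊕y≡1⇔ x y)
      ((λ x≡cy → z≢c (Equivalence.to x≡cy⇔z≡c x≡cy)) , ≡.trans x≡iz (≡.sym i[x/y]≡iz)))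
    where
    y : Fin m
    y = x ∙ z ⁻¹
    i[x/y]≡iz : i (x ∙ y ⁻¹) ≡ i z
    i[x/y]≡iz = ≡.cong i (x∙[x∙y⁻¹]⁻¹≈y x z)
    x≡cy⇔z≡c : (x ≡ c ∙ y) ⇔ (z ≡ c)
    x≡cy⇔z≡c = x≈c∙[x∙z⁻¹]⇔z≈c c x z

  module _ {a ℓ : Level} (K : CommutativeRing a ℓ) where
    open CommutativeRing K using (Carrier; _≈_; setoid)
    open SumProperties (CommutativeRing.+-commutativeMonoid K) using (∑-comm; ∑-permute; sum-cong-≋)
    open IndicatorSums K
    open SetoidReasoning setoid

    ∑∑[x⊕y≡1]≈∑[z≢c] : (F : Fin m → Fin m → Carrier) →
      ∑ K (λ x → ∑ K (λ y → when K (_⊕_ X c i (just x) (just y) ≟F just ε) (F x y)))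
        ≈ ∑ K (λ z → when K (¬? (z ≟ c)) (F (i z) (i z ∙ z ⁻¹)))
    ∑∑[x⊕y≡1]≈∑[z≢c] F = begin
      ∑ K (λ x → ∑ K (λ y → when K (_⊕_ X c i (just x) (just y) ≟F just ε) (F x y)))
        ≈⟨ sum-cong-≋ (λ x → ∑-permute _ (x/-permutation x)) ⟩
      ∑ K (λ x → ∑ K (λ z →
        when K (_⊕_ X c i (just x) (just (x ∙ z ⁻¹)) ≟F just ε) (F x (x ∙ z ⁻¹))))
        ≈⟨ sum-cong-≋ (λ x → sum-cong-≋ (λ z → [x⊕x∙z⁻¹≡1]≈[x≡iz][z≢c] x z)) ⟩
      ∑ K (λ x → ∑ K (λ z → when K (x ≟ i z) (when K (¬? (z ≟ c)) (F x (x ∙ z ⁻¹)))))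
        ≈⟨ ∑-comm (λ x z → when K (x ≟ i z) (when K (¬? (z ≟ c)) (F x (x ∙ z ⁻¹)))) ⟩
      ∑ K (λ z → ∑ K (λ x → when K (x ≟ i z) (when K (¬? (z ≟ c)) (F x (x ∙ z ⁻¹)))))
        ≈⟨ sum-cong-≋ (λ z → ∑-when-≡ (i z) (λ x → when K (¬? (z ≟ c)) (F x (x ∙ z ⁻¹)))) ⟩
      ∑ K (λ z → when K (¬? (z ≟ c)) (F (i z) (i z ∙ z ⁻¹))) ∎
      where
      x/-permutation : Fin m → Permutation m m
      x/-permutation x = permutation (λ z → x ∙ z ⁻¹) (λ z → x ∙ z ⁻¹)
        (x∙[x∙y⁻¹]⁻¹≈y x) (x∙[x∙y⁻¹]⁻¹≈y x)

      [x⊕x∙z⁻¹≡1]≈[x≡iz][z≢c] : ∀ x z →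
        when K (_⊕_ X c i (just x) (just (x ∙ z ⁻¹)) ≟F just ε) (F x (x ∙ z ⁻¹))
          ≈ when K (x ≟ i z) (when K (¬? (z ≟ c)) (F x (x ∙ z ⁻¹)))
      [x⊕x∙z⁻¹≡1]≈[x≡iz][z≢c] x z = begin
        when K (_⊕_ X c i (just x) (just (x ∙ z ⁻¹)) ≟F just ε) (F x (x ∙ z ⁻¹))
          ≈⟨ when-cong-⇔ (_⊕_ X c i (just x) (just (x ∙ z ⁻¹)) ≟F just ε)
                         (x ≟ i z ×-dec ¬? (z ≟ c)) (x⊕x∙z⁻¹≡1⇔ x z) (F x (x ∙ z ⁻¹)) ⟩
        when K (x ≟ i z ×-dec ¬? (z ≟ c)) (F x (x ∙ z ⁻¹))
          ≈⟨ when-×-dec (x ≟ i z) (¬? (z ≟ c)) _ ⟩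
        when K (x ≟ i z) (when K (¬? (z ≟ c)) (F x (x ∙ z ⁻¹))) ∎

lemma5p4 : {a ℓ : Level} (K : CommutativeRing a ℓ) →
    let open CommutativeRing K in
    {m : ℕ} (M X : FinAbGroup m) →
    let module M = FinAbGroup M
        module X = FinAbGroup X
    in
    -- X plays the role of M̂, ⟨ α , x ⟩ = α(x)
    (⟨_,_⟩ : Fin m → Fin m → Carrier) → IsDualPairing K M X ⟨_,_⟩ →
    -- minv = 1/m
    (minv : Carrier) → natK K m * minv ≈ 1# →
    -- J is a Jacobi function on M
    (J : Fin m → Fin m → Carrier) → IsJacobi K M J →
    -- c ∈ M̂ with c² = 1
    (c : Fin m) → c X.∙ c ≡ X.ε →
    -- i : M̂∖{c} → M̂∖{1} a bijection
    (i : Fin m → Fin m) → IsBijectionOff X c i →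
    (∀ x → x ≢ c → i x ≡ x X.∙ i (x X.⁻¹)) →
    (∀ α β → J α β ≈ minv * ∑ K (λ x →
        when K (¬? (x ≟ c)) (⟨ α , i x ⟩ * ⟨ β , i x X.∙ x X.⁻¹ ⟩))) →
    ∀ α β → J α β ≈ minv * ∑ K (λ x → ∑ K (λ y →
        when K (_⊕_ X c i (just x) (just y) ≟F just X.ε) (⟨ α , x ⟩ * ⟨ β , y ⟩)))
lemma5p4 K M X ⟨_,_⟩ _ minv _ J _ c _ i _ _ J≈∑[z≢c] α β = begin
  J α β
    ≈⟨ J≈∑[z≢c] α β ⟩
  minv * ∑ K (λ z → when K (¬? (z ≟ c)) (⟨ α , i z ⟩ * ⟨ β , i z X.∙ z X.⁻¹ ⟩))
    ≈⟨ *-congˡ (∑∑[x⊕y≡1]≈∑[z≢c] K (λ x y → ⟨ α , x ⟩ * ⟨ β , y ⟩)) ⟨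
  minv * ∑ K (λ x → ∑ K (λ y →
    when K (_⊕_ X c i (just x) (just y) ≟F just X.ε) (⟨ α , x ⟩ * ⟨ β , y ⟩))) ∎
  where
  open CommutativeRing K
  open SetoidReasoning setoid
  module X = FinAbGroup X
  open SolutionsOf⊕≡1 X c i
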